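{- Let $m \ge 5$ be an integer and let $G = P_5 \mathbin{\Box} P_m$. Then \[ m(G,3)= \begin{cases} 2m+2, & m \text{ odd},\\ 2m+3, & m \text{ even}. \end{cases} \]
   Context: For a graph $G$ and an integer $r \ge 2$, the $r$-neighbor bootstrap percolation process starting from a set $A_0 \subseteq V(G)$ of initially infected vertices is defined by $A_t = A_{t-1} \cup \{ v \in V(G) : |N_G(v) \cap A_{t-1}| \ge r\}$ for $t \ge 1$. The set $A_0$ is $r$-percolating if $\bigcup_{t \ge 0} A_t = V(G)$. The $r$-percolation number $m(G,r)$ is the minimum cardinality of an $r$-percolating set of $G$. $P_n$ denotes the path on $n$ vertices and $\mathbin{\Box}$ denotes the Cartesian product of graphs, so $P_n \mathbin{\Box} P_m$ is the $n \times m$ grid graph. -}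

module Defs where

open import Data.Nat using (ℕ; zero; suc; _+_; _*_; _≤_; _≤ᵇ_; _%_)
open import Data.Bool using (Bool; true; false; _∧_; _∨_; if_then_else_)
open import Data.Fin using (Fin; toℕ; remQuot)
open import Data.Fin.Subset using (Subset; inside; outside; ⊤; ∣_∣)
open import Data.Fin.Subset using (_∈_) public
open import Data.Vec using (Vec; tabulate; lookup)
open import Data.List using (List; map)
open import Data.Nat.ListAction using (sum)
open import Data.List using () renaming (allFin to allFinL)
open import Data.Product using (Σ; ∃; _×_; _,_)
open import Relation.Binary.PropositionalEquality using (_≡_)

record Graph : Set where
  field
    size : ℕ
    adj  : Fin size → Fin size → Bool
open Graph public

_=ᶠ_ : {n : ℕ} → Fin n → Fin n → Bool
i =ᶠ j = Data.Nat._≡ᵇ_ (toℕ i) (toℕ j)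

P : ℕ → Graph
P n = record { size = n ; adj = λ i j → Data.Nat._≡ᵇ_ (suc (toℕ i)) (toℕ j) ∨ Data.Nat._≡ᵇ_ (suc (toℕ j)) (toℕ i) }

-- Cartesian product G □ H, vertex (g , h) encoded as an element of Fin (|G| * |H|)
-- via Data.Fin.remQuot / combine.
_□_ : Graph → Graph → Graph
G □ H = record { size = size G * size H ; adj = a }
  where
  a : Fin (size G * size H) → Fin (size G * size H) → Bool
  a u v with remQuot (size H) u | remQuot (size H) v
  ... | (g₁ , h₁) | (g₂ , h₂) = ((g₁ =ᶠ g₂) ∧ adj H h₁ h₂) ∨ ((h₁ =ᶠ h₂) ∧ adj G g₁ g₂)

isIn : {n : ℕ} → Subset n → Fin n → Bool
isIn A v with lookup A v
... | inside  = true
... | outside = false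

nbrCount : (G : Graph) → Subset (size G) → Fin (size G) → ℕ
nbrCount G A v = sum (map (λ w → if adj G v w ∧ isIn A w then 1 else 0) (allFinL (size G)))

step : (G : Graph) → ℕ → Subset (size G) → Subset (size G)
step G r A = tabulate λ v → if isIn A v ∨ (r ≤ᵇ nbrCount G A v) then inside else outside

infected : (G : Graph) → ℕ → Subset (size G) → ℕ → Subset (size G)
infected G r A zero    = A
infected G r A (suc t) = step G r (infected G r A t)

-- A₀ is r-percolating iff ⋃_t A_t = V(G); since the A_t increase, this is ∃ t. A_t = V(G)
Percolating : (G : Graph) → ℕ → Subset (size G) → Set
Percolating G r A = ∃ λ t → infected G r A t ≡ ⊤

IsPercolationNumber : Graph → ℕ → ℕ → Set
IsPercolationNumber G r k =
  (Σ (Subset (size G)) λ A → (∣ A ∣ ≡ k) × Percolating G r A)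
  × ((A : Subset (size G)) → Percolating G r A → k ≤ ∣ A ∣)

-- Lower bound: for a set A write e(A) for the number of edges inside A. A vertex infected in one
-- step has at least r infected neighbours, so Φ(A) = 2r|A| - 2e(A) never increases along the
-- r-neighbour process. For a 3-percolating set A of P₅ □ P_m comparing Φ(A) with Φ(V) gives
-- 6|A| ≥ 30m - 2e(G) + 2e(A) = 12m + 10 + 2e(A), hence |A| ≥ 2m + 2. For even m more is true:
-- the corners (degree 2) lie in A and no two adjacent vertices of the top row (degree ≤ 3) are both
-- missing from A, since neither could ever be infected. A row with both ends in A, no two
-- consecutive gaps and an even number of vertices contains two adjacent vertices of A; the top and
-- bottom rows give e(A) ≥ 2 and so |A| ≥ 2m + 3.
--
-- Upper bound: an explicit seed with rows {0,2,4} in the first and last column and alternately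
-- rows {0,4} and {1,3} in between (plus one more full column when m is even) percolates column by
-- column.

module Submission where

open import Data.Nat
  using (ℕ; zero; suc; _+_; _*_; _/_; _%_; _⊔_; _≤_; _<_; _≤′_; ≤′-refl; ≤′-step; z≤n; s≤s; z<s; _≡ᵇ_; _≤ᵇ_)
open import Data.Nat.Properties
open import Data.Bool using (Bool; true; false; T; not; _∧_; _∨_; if_then_else_)
open import Data.Bool.Properties using (T-∨; T-∧; T?; ∨-comm; ∨-identityʳ)
open import Data.Empty using (⊥-elim)
open import Data.Fin using (Fin; zero; suc; toℕ; combine; remQuot; punchIn; punchOut; _↑ˡ_; _↑ʳ_)
import Data.Fin.Properties as Fin
open import Data.Fin.Subset using (Subset; inside; outside; ⊤; ∣_∣)
open import Data.Fin.Subset.Properties using (∣⊤∣≡n)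
open import Data.Vec using ([]; _∷_; lookup; tabulate)
open import Data.Vec.Properties using (lookup∘tabulate)
open import Data.Product using (∃; _×_; _,_; proj₁; proj₂)
open import Data.Sum using (_⊎_; inj₁; inj₂)
open import Function using (_∘_; _$_; case_of_; Injective; Equivalence)
open import Relation.Nullary using (¬_; yes; no)
open import Relation.Binary.PropositionalEquality
open import Algebra.Properties.Semiring.Sum +-*-semiring
  using (sum; sum-syntax; sum-cong-≗; sum-remove; ∑-distrib-+; ∑-comm; *-distribˡ-sum; *-distribʳ-sum)
open import Data.Nat.Tactic.RingSolver using (solve-∀)
open import Data.Nat.DivMod using (m≡m%n+[m/n]*n)

import Data.List as List
import Data.Nat.ListAction as ListAction

open import Defs

-- Finite sums

𝕀 : Bool → ℕ
𝕀 b = if b then 1 else 0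

sum-mono-≤ : ∀ {n} {f g : Fin n → ℕ} → (∀ i → f i ≤ g i) → sum f ≤ sum g
sum-mono-≤ {zero}  f≤g = z≤n
sum-mono-≤ {suc n} f≤g = +-mono-≤ (f≤g zero) (sum-mono-≤ (f≤g ∘ suc))

sum-const : ∀ n c → ∑[ i < n ] c ≡ n * c
sum-const zero    c = refl
sum-const (suc n) c = cong (c +_) (sum-const n c)

sum-≤-injective : ∀ {k n} (f : Fin n → ℕ) (g : Fin k → Fin n) → Injective _≡_ _≡_ g →
                  sum (f ∘ g) ≤ sum f
sum-≤-injective {zero}            f g g-inj = z≤n
sum-≤-injective {suc k} {zero}    f g g-inj with () ← g zero
sum-≤-injective {suc k} {suc n}   f g g-inj = begin
  f (g zero) + sum (f ∘ g ∘ suc)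
    ≡⟨ cong (f (g zero) +_) (sum-cong-≗ (cong f ∘ sym ∘ Fin.punchIn-punchOut ∘ g₀≢)) ⟩
  f (g zero) + sum (f ∘ punchIn (g zero) ∘ h)
    ≤⟨ +-monoʳ-≤ (f (g zero)) (sum-≤-injective (f ∘ punchIn (g zero)) h h-inj) ⟩
  f (g zero) + sum (f ∘ punchIn (g zero))
    ≡⟨ sum-remove f ⟨
  sum f ∎
  where
  open ≤-Reasoning
  g₀≢ : ∀ i → g zero ≢ g (suc i)
  g₀≢ i eq with () ← g-inj eq
  h : Fin k → Fin n
  h i = punchOut (g₀≢ i)
  h-inj : Injective _≡_ _≡_ h
  h-inj eq = Fin.suc-injective (g-inj (Fin.punchOut-injective (g₀≢ _) (g₀≢ _) eq))

sum-↑ : ∀ m n (f : Fin (m + n) → ℕ) → sum f ≡ sum (f ∘ (_↑ˡ n)) + sum (f ∘ (m ↑ʳ_))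
sum-↑ zero    n f = refl
sum-↑ (suc m) n f = trans (cong (f zero +_) (sum-↑ m n (f ∘ suc))) (sym (+-assoc (f zero) _ _))

sum-combine : ∀ m n (f : Fin (m * n) → ℕ) → sum f ≡ ∑[ i < m ] ∑[ j < n ] f (combine i j)
sum-combine zero    n f = refl
sum-combine (suc m) n f =
  trans (sum-↑ n (m * n) f) (cong (sum (f ∘ (_↑ˡ m * n)) +_) (sum-combine m n (f ∘ (n ↑ʳ_))))

sum-zero : ∀ n → ∑[ i < n ] 0 ≡ 0
sum-zero n = trans (sum-const n 0) (*-zeroʳ n)

sum-delta : ∀ {n} (i : Fin n) (f : Fin n → ℕ) → ∑[ j < n ] (𝕀 (i =ᶠ j) * f j) ≡ f i
sum-delta {suc n} zero    f = trans (cong₂ _+_ (+-identityʳ (f zero)) (sum-zero n)) (+-identityʳ (f zero))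
sum-delta (suc i) f = sum-delta i (f ∘ suc)

term≤sum : ∀ {n} (f : Fin n → ℕ) i → f i ≤ sum f
term≤sum f i = subst (_≤ sum f) (+-identityʳ (f i)) (sum-≤-injective {1} f (λ _ → i) single-injective)
  where
  single-injective : Injective _≡_ _≡_ (λ (_ : Fin 1) → i)
  single-injective {zero} {zero} _ = refl

two-terms≤sum : ∀ {n} (f : Fin n → ℕ) {i j} → i ≢ j → f i + f j ≤ sum f
two-terms≤sum f {i} {j} i≢j =
  subst (_≤ sum f) (cong (f i +_) (+-identityʳ (f j))) (sum-≤-injective {2} f pair pair-injective)
  where
  pair : Fin 2 → _
  pair zero       = i
  pair (suc zero) = j
  pair-injective : Injective _≡_ _≡_ pair
  pair-injective {zero}     {zero}     _  = refl
  pair-injective {zero}     {suc zero} eq = ⊥-elim (i≢j eq)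
  pair-injective {suc zero} {zero}     eq = ⊥-elim (i≢j (sym eq))
  pair-injective {suc zero} {suc zero} _  = refl

listSum-tabulate : ∀ {X : Set} n (f : X → ℕ) (g : Fin n → X) →
                   ListAction.sum (List.map f (List.tabulate g)) ≡ sum (f ∘ g)
listSum-tabulate zero    f g = refl
listSum-tabulate (suc n) f g = cong (f (g zero) +_) (listSum-tabulate n f (g ∘ suc))

+-≤-chain : ∀ {a b c x y z} → a + x ≤ b + y → b + z ≤ c + x → a + z ≤ c + y
+-≤-chain {a} {b} {c} {x} {y} {z} p q = +-cancelʳ-≤ (b + x) (a + z) (c + y) (begin
  a + z + (b + x)   ≡⟨ swap-inner a z b x ⟩
  (a + x) + (b + z) ≤⟨ +-mono-≤ p q ⟩
  (b + y) + (c + x) ≡⟨ swap-outer b y c x ⟩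
  c + y + (b + x)   ∎)
  where
  open ≤-Reasoning
  swap-inner : ∀ a b c d → a + b + (c + d) ≡ a + d + (c + b)
  swap-inner = solve-∀
  swap-outer : ∀ a b c d → a + b + (c + d) ≡ c + b + (a + d)
  swap-outer = solve-∀

χ : ∀ {n} → Subset n → Fin n → ℕ
χ A v = 𝕀 (isIn A v)

𝕀-T : ∀ {b} → T b → 𝕀 b ≡ 1
𝕀-T {true} _ = refl

χ-∉ : ∀ {n} (A : Subset n) v → ¬ T (isIn A v) → χ A v ≡ 0
χ-∉ A v v∉A with isIn A v
... | true  = ⊥-elim (v∉A _)
... | false = refl

χ≤1 : ∀ {n} (A : Subset n) v → χ A v ≤ 1
χ≤1 A v with isIn A v
... | true  = ≤-refl
... | false = z≤n

𝕀-∧ : ∀ x y → 𝕀 (x ∧ y) ≡ 𝕀 x * 𝕀 y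
𝕀-∧ true  y = sym (+-identityʳ (𝕀 y))
𝕀-∧ false y = refl

≡ᵇ-comm : ∀ m n → (m ≡ᵇ n) ≡ (n ≡ᵇ m)
≡ᵇ-comm zero    zero    = refl
≡ᵇ-comm zero    (suc n) = refl
≡ᵇ-comm (suc m) zero    = refl
≡ᵇ-comm (suc m) (suc n) = ≡ᵇ-comm m n

=ᶠ-comm : ∀ {n} (i j : Fin n) → (i =ᶠ j) ≡ (j =ᶠ i)
=ᶠ-comm i j = ≡ᵇ-comm (toℕ i) (toℕ j)

=ᶠ⇒≡ : ∀ {n} {i j : Fin n} → T (i =ᶠ j) → i ≡ j
=ᶠ⇒≡ {i = i} {j} i=j = Fin.toℕ-injective (≡ᵇ⇒≡ (toℕ i) (toℕ j) i=j)

=ᶠ-refl : ∀ {n} (i : Fin n) → T (i =ᶠ i)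
=ᶠ-refl i = ≡⇒≡ᵇ (toℕ i) (toℕ i) refl

isIn≡lookup : ∀ {n} (A : Subset n) v → isIn A v ≡ lookup A v
isIn≡lookup A v with lookup A v
... | true  = refl
... | false = refl

∣∣≡sum-χ : ∀ {n} (A : Subset n) → ∣ A ∣ ≡ sum (χ A)
∣∣≡sum-χ []          = refl
∣∣≡sum-χ (true ∷ A)  = cong suc (∣∣≡sum-χ A)
∣∣≡sum-χ (false ∷ A) = ∣∣≡sum-χ A

isIn-⊤ : ∀ {n} (v : Fin n) → isIn ⊤ v ≡ true
isIn-⊤ zero    = refl
isIn-⊤ (suc v) = isIn-⊤ v

all-in⇒⊤ : ∀ {n} (A : Subset n) → (∀ v → T (isIn A v)) → A ≡ ⊤
all-in⇒⊤ []          all = refl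
all-in⇒⊤ (true ∷ A)  all = cong (inside ∷_) (all-in⇒⊤ A (all ∘ suc))
all-in⇒⊤ (false ∷ A) all = ⊥-elim (all zero)

-- Bootstrap percolation on a graph

module _ (G : Graph) where

  private
    V = Fin (size G)

  edge : V → V → ℕ
  edge v w = 𝕀 (adj G v w)

  degree : V → ℕ
  degree v = ∑[ w < size G ] edge v w

  Symmetric : Set
  Symmetric = ∀ v w → adj G v w ≡ adj G w v

  nbrCount-sum : ∀ A v → nbrCount G A v ≡ ∑[ w < size G ] (edge v w * χ A w)
  nbrCount-sum A v = trans (listSum-tabulate (size G) _ (λ w → w)) (sum-cong-≗ λ w → 𝕀-∧ (adj G v w) (isIn A w))

  edge*χ≤edge : ∀ A v w → edge v w * χ A w ≤ edge v w
  edge*χ≤edge A v w = subst (edge v w * χ A w ≤_) (*-identityʳ (edge v w)) (*-monoʳ-≤ (edge v w) (χ≤1 A w))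

  nbrCount≤degree : ∀ A v → nbrCount G A v ≤ degree v
  nbrCount≤degree A v = subst (_≤ degree v) (sym (nbrCount-sum A v)) (sum-mono-≤ (edge*χ≤edge A v))

  nbrCount<degree : ∀ A v w → T (adj G v w) → ¬ T (isIn A w) → nbrCount G A v < degree v
  nbrCount<degree A v w v~w w∉A = begin-strict
    nbrCount G A v
      ≡⟨ nbrCount-sum A v ⟩
    ∑[ u < size G ] (edge v u * χ A u)
      <⟨ m<m+n _ (≤-reflexive (sym (𝕀-T v~w))) ⟩
    ∑[ u < size G ] (edge v u * χ A u) + edge v w
      ≡⟨ cong (_ +_) (sum-delta w (edge v)) ⟨
    ∑[ u < size G ] (edge v u * χ A u) + ∑[ u < size G ] (𝕀 (w =ᶠ u) * edge v u)
      ≡⟨ ∑-distrib-+ (λ u → edge v u * χ A u) (λ u → 𝕀 (w =ᶠ u) * edge v u) ⟨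
    ∑[ u < size G ] (edge v u * χ A u + 𝕀 (w =ᶠ u) * edge v u)
      ≤⟨ sum-mono-≤ term≤edge ⟩
    degree v ∎
    where
    open ≤-Reasoning
    term≤edge : ∀ u → edge v u * χ A u + 𝕀 (w =ᶠ u) * edge v u ≤ edge v u
    term≤edge u with w =ᶠ u in w=u
    ... | false = subst (_≤ edge v u) (sym (+-identityʳ _)) (edge*χ≤edge A v u)
    ... | true with refl ← =ᶠ⇒≡ {i = w} {u} (subst T (sym w=u) _) =
      ≤-reflexive (cong₂ _+_ (trans (cong (edge v w *_) (χ-∉ A w w∉A)) (*-zeroʳ (edge v w)))
                             (+-identityʳ (edge v w)))

  isIn-step : ∀ r A v → isIn (step G r A) v ≡ isIn A v ∨ (r ≤ᵇ nbrCount G A v)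
  isIn-step r A v = trans (isIn≡lookup (step G r A) v) (trans (lookup∘tabulate _ v) (if-inside _))
    where
    if-inside : ∀ b → (if b then inside else outside) ≡ b
    if-inside true  = refl
    if-inside false = refl

  newlyInfected : ℕ → Subset (size G) → V → Bool
  newlyInfected r A v = not (isIn A v) ∧ (r ≤ᵇ nbrCount G A v)

  χ-step : ∀ r A v → χ (step G r A) v ≡ χ A v + 𝕀 (newlyInfected r A v)
  χ-step r A v rewrite isIn-step r A v with isIn A v
  ... | true  = refl
  ... | false = refl

  newlyInfected-threshold : ∀ r A v →
    𝕀 (newlyInfected r A v) * r ≤ 𝕀 (newlyInfected r A v) * nbrCount G A v
  newlyInfected-threshold r A v with newlyInfected r A v in new
  ... | false = z≤n
  ... | true  = *-monoʳ-≤ 1 (≤ᵇ⇒≤ r _ (proj₂ (Equivalence.to T-∧ (subst T (sym new) _))))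

  adjForm : (V → ℕ) → (V → ℕ) → ℕ
  adjForm x y = ∑[ v < size G ] ∑[ w < size G ] (x v * edge v w * y w)

  orderedEdges : Subset (size G) → ℕ
  orderedEdges A = adjForm (χ A) (χ A)

  orderedEdges-⊤ : orderedEdges ⊤ ≡ ∑[ v < size G ] degree v
  orderedEdges-⊤ = sum-cong-≗ λ v → sum-cong-≗ λ w → begin
    χ ⊤ v * edge v w * χ ⊤ w ≡⟨ cong₂ (λ a b → 𝕀 a * edge v w * 𝕀 b) (isIn-⊤ v) (isIn-⊤ w) ⟩
    1 * edge v w * 1         ≡⟨ *-identityʳ (1 * edge v w) ⟩
    1 * edge v w             ≡⟨ *-identityˡ (edge v w) ⟩
    edge v w                 ∎
    where open ≡-Reasoning

  adjForm-cong : ∀ {x x′ y y′} → (∀ v → x v ≡ x′ v) → (∀ w → y w ≡ y′ w) →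
                 adjForm x y ≡ adjForm x′ y′
  adjForm-cong x≗x′ y≗y′ =
    sum-cong-≗ λ v → sum-cong-≗ λ w → cong₂ (λ a b → a * edge v w * b) (x≗x′ v) (y≗y′ w)

  adjForm-distribˡ : ∀ x x′ y → adjForm (λ v → x v + x′ v) y ≡ adjForm x y + adjForm x′ y
  adjForm-distribˡ x x′ y = trans
    (sum-cong-≗ λ v → trans (sum-cong-≗ λ w → distrib v w) (∑-distrib-+ (λ w → x v * edge v w * y w) _))
    (∑-distrib-+ (λ v → ∑[ w < size G ] (x v * edge v w * y w)) _)
    where
    distrib : ∀ v w → (x v + x′ v) * edge v w * y w ≡ x v * edge v w * y w + x′ v * edge v w * y w
    distrib v w = trans (cong (_* y w) (*-distribʳ-+ (edge v w) (x v) (x′ v)))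
                        (*-distribʳ-+ (y w) (x v * edge v w) (x′ v * edge v w))

  adjForm-distribʳ : ∀ x y y′ → adjForm x (λ w → y w + y′ w) ≡ adjForm x y + adjForm x y′
  adjForm-distribʳ x y y′ = trans
    (sum-cong-≗ λ v → trans (sum-cong-≗ λ w → distrib v w) (∑-distrib-+ (λ w → x v * edge v w * y w) _))
    (∑-distrib-+ (λ v → ∑[ w < size G ] (x v * edge v w * y w)) _)
    where
    distrib : ∀ v w → x v * edge v w * (y w + y′ w) ≡ x v * edge v w * y w + x v * edge v w * y′ w
    distrib v w = *-distribˡ-+ (x v * edge v w) (y w) (y′ w)

  adjForm-comm : Symmetric → ∀ x y → adjForm x y ≡ adjForm y x
  adjForm-comm sym-adj x y =
    trans (∑-comm (λ v w → x v * edge v w * y w)) (sum-cong-≗ λ w → sum-cong-≗ λ v → swap v w)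
    where
    swap : ∀ v w → x v * edge v w * y w ≡ y w * edge w v * x v
    swap v w rewrite sym-adj v w = mirror (x v) (edge w v) (y w)
      where
      mirror : ∀ a b c → a * b * c ≡ c * b * a
      mirror = solve-∀

  adjForm-χʳ : ∀ x A → adjForm x (χ A) ≡ ∑[ v < size G ] (x v * nbrCount G A v)
  adjForm-χʳ x A = sum-cong-≗ λ v → begin
    ∑[ w < size G ] (x v * edge v w * χ A w)   ≡⟨ sum-cong-≗ (λ w → *-assoc (x v) (edge v w) (χ A w)) ⟩
    ∑[ w < size G ] (x v * (edge v w * χ A w)) ≡⟨ *-distribˡ-sum (x v) (λ w → edge v w * χ A w) ⟨
    x v * ∑[ w < size G ] (edge v w * χ A w)   ≡⟨ cong (x v *_) (nbrCount-sum A v) ⟨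
    x v * nbrCount G A v                       ∎
    where open ≡-Reasoning

  1≤χ*nbrCount : ∀ A v w → T (adj G v w) → T (isIn A v) → T (isIn A w) → 1 ≤ χ A v * nbrCount G A v
  1≤χ*nbrCount A v w v~w v∈A w∈A = begin
    1                                    ≡⟨ cong₂ _*_ (𝕀-T v~w) (𝕀-T w∈A) ⟨
    edge v w * χ A w                     ≤⟨ term≤sum (λ u → edge v u * χ A u) w ⟩
    ∑[ u < size G ] (edge v u * χ A u)   ≡⟨ nbrCount-sum A v ⟨
    nbrCount G A v                       ≡⟨ *-identityˡ _ ⟨
    1 * nbrCount G A v                   ≡⟨ cong (_* nbrCount G A v) (𝕀-T v∈A) ⟨
    χ A v * nbrCount G A v               ∎
    where open ≤-Reasoning

  module _ (r : ℕ) (A : Subset (size G)) where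

    private
      B = step G r A
      δ : V → ℕ
      δ v = 𝕀 (newlyInfected r A v)

    ∣step∣ : ∣ B ∣ ≡ ∣ A ∣ + sum δ
    ∣step∣ = begin
      ∣ B ∣                                 ≡⟨ ∣∣≡sum-χ B ⟩
      sum (χ B)                             ≡⟨ sum-cong-≗ (χ-step r A) ⟩
      ∑[ v < size G ] (χ A v + δ v)         ≡⟨ ∑-distrib-+ (χ A) δ ⟩
      sum (χ A) + sum δ                     ≡⟨ cong (_+ sum δ) (∣∣≡sum-χ A) ⟨
      ∣ A ∣ + sum δ                         ∎
      where open ≡-Reasoning

    newlyInfected-threshold-∑ : sum δ * r ≤ adjForm δ (χ A)
    newlyInfected-threshold-∑ = begin
      sum δ * r                             ≡⟨ *-distribʳ-sum r δ ⟩
      ∑[ v < size G ] (δ v * r)             ≤⟨ sum-mono-≤ (newlyInfected-threshold r A) ⟩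
      ∑[ v < size G ] (δ v * nbrCount G A v) ≡⟨ adjForm-χʳ δ A ⟨
      adjForm δ (χ A)                          ∎
      where open ≤-Reasoning

    orderedEdges-step : Symmetric → orderedEdges A + 2 * (sum δ * r) ≤ orderedEdges B
    orderedEdges-step sym-adj = begin
      orderedEdges A + 2 * (sum δ * r)
        ≤⟨ +-monoʳ-≤ (orderedEdges A) (*-monoʳ-≤ 2 newlyInfected-threshold-∑) ⟩
      orderedEdges A + 2 * adjForm δ (χ A)
        ≡⟨ cong (orderedEdges A +_) (cong₂ _+_ (adjForm-comm sym-adj (χ A) δ) (sym (+-identityʳ _))) ⟨
      orderedEdges A + (adjForm (χ A) δ + adjForm δ (χ A))
        ≤⟨ +-monoʳ-≤ (orderedEdges A) (+-monoʳ-≤ (adjForm (χ A) δ) (m≤m+n _ _)) ⟩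
      orderedEdges A + (adjForm (χ A) δ + (adjForm δ (χ A) + adjForm δ δ))
        ≡⟨ +-assoc (orderedEdges A) _ _ ⟨
      (adjForm (χ A) (χ A) + adjForm (χ A) δ) + (adjForm δ (χ A) + adjForm δ δ)
        ≡⟨ cong₂ _+_ (adjForm-distribʳ (χ A) (χ A) δ) (adjForm-distribʳ δ (χ A) δ) ⟨
      adjForm (χ A) (λ w → χ A w + δ w) + adjForm δ (λ w → χ A w + δ w)
        ≡⟨ adjForm-distribˡ (χ A) δ _ ⟨
      adjForm (λ v → χ A v + δ v) (λ w → χ A w + δ w)
        ≡⟨ adjForm-cong (sym ∘ χ-step r A) (sym ∘ χ-step r A) ⟩
      orderedEdges B ∎
      where open ≤-Reasoning

    -- Φ(A) = 2r|A| - orderedEdges A does not increase under one step of the process.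
    potential-step : Symmetric → orderedEdges A + 2 * r * ∣ B ∣ ≤ orderedEdges B + 2 * r * ∣ A ∣
    potential-step sym-adj = begin
      orderedEdges A + 2 * r * ∣ B ∣
        ≡⟨ cong (λ b → orderedEdges A + 2 * r * b) ∣step∣ ⟩
      orderedEdges A + 2 * r * (∣ A ∣ + sum δ)
        ≡⟨ regroup (orderedEdges A) ∣ A ∣ (sum δ) r ⟩
      orderedEdges A + 2 * (sum δ * r) + 2 * r * ∣ A ∣
        ≤⟨ +-monoˡ-≤ (2 * r * ∣ A ∣) (orderedEdges-step sym-adj) ⟩
      orderedEdges B + 2 * r * ∣ A ∣ ∎
      where
      open ≤-Reasoning
      regroup : ∀ o a s r → o + 2 * r * (a + s) ≡ o + 2 * (s * r) + 2 * r * a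
      regroup = solve-∀

  potential-infected : Symmetric → ∀ r A t →
    orderedEdges A + 2 * r * ∣ infected G r A t ∣ ≤ orderedEdges (infected G r A t) + 2 * r * ∣ A ∣
  potential-infected sym-adj r A zero    = ≤-refl
  potential-infected sym-adj r A (suc t) =
    +-≤-chain {b = orderedEdges (infected G r A t)} {x = 2 * r * ∣ infected G r A t ∣}
      (potential-infected sym-adj r A t) (potential-step r (infected G r A t) sym-adj)

  potential-percolating : Symmetric → ∀ r A → Percolating G r A →
    orderedEdges A + 2 * r * size G ≤ orderedEdges ⊤ + 2 * r * ∣ A ∣
  potential-percolating sym-adj r A (t , A-t≡⊤) =
    subst (λ n → orderedEdges A + 2 * r * n ≤ orderedEdges ⊤ + 2 * r * ∣ A ∣) (∣⊤∣≡n (size G))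
      (subst (λ B → orderedEdges A + 2 * r * ∣ B ∣ ≤ orderedEdges B + 2 * r * ∣ A ∣) A-t≡⊤
        (potential-infected sym-adj r A t))

  EventuallyInfected : ℕ → Subset (size G) → V → Set
  EventuallyInfected r A v = ∃ λ t → T (isIn (infected G r A t) v)

  module _ (r : ℕ) (A : Subset (size G)) where

    step-⊇ : ∀ B v → T (isIn B v) → T (isIn (step G r B) v)
    step-⊇ B v v∈B = subst T (sym (isIn-step r B v)) (Equivalence.from T-∨ (inj₁ v∈B))

    infected-mono : ∀ {t s} v → t ≤ s → T (isIn (infected G r A t) v) → T (isIn (infected G r A s) v)
    infected-mono v t≤s = go (≤⇒≤′ t≤s)
      where
      go : ∀ {t s} → t ≤′ s → T (isIn (infected G r A t) v) → T (isIn (infected G r A s) v)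
      go ≤′-refl        = λ v∈ → v∈
      go {s = suc s} (≤′-step t≤′s) v∈ = step-⊇ (infected G r A s) v (go t≤′s v∈)

    eventually-simultaneously : ∀ {k} (g : Fin k → V) → (∀ i → EventuallyInfected r A (g i)) →
      ∃ λ t → ∀ i → T (isIn (infected G r A t) (g i))
    eventually-simultaneously {zero}  g ev = 0 , λ ()
    eventually-simultaneously {suc k} g ev with ev zero | eventually-simultaneously (g ∘ suc) (ev ∘ suc)
    ... | t₀ , g₀∈ | t , gs∈ = t₀ ⊔ t , λ where
      zero    → infected-mono (g zero) (m≤m⊔n t₀ t) g₀∈
      (suc i) → infected-mono (g (suc i)) (m≤n⊔m t₀ t) (gs∈ i)

    eventually-by-neighbours : ∀ v (g : Fin r → V) → Injective _≡_ _≡_ g → (∀ i → T (adj G v (g i))) →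
      (∀ i → EventuallyInfected r A (g i)) → EventuallyInfected r A v
    eventually-by-neighbours v g g-inj v~g ev with eventually-simultaneously g ev
    ... | t , g∈ = suc t , subst T (sym (isIn-step r (infected G r A t) v))
                             (Equivalence.from T-∨ (inj₂ (≤⇒≤ᵇ r≤nbrCount)))
      where
      A-t = infected G r A t
      one : ∀ i → 1 ≡ edge v (g i) * χ A-t (g i)
      one i = sym (cong₂ _*_ (𝕀-T (v~g i)) (𝕀-T (g∈ i)))
      r≤nbrCount : r ≤ nbrCount G A-t v
      r≤nbrCount = begin
        r                                          ≡⟨ trans (sym (*-identityʳ r)) (sym (sum-const r 1)) ⟩
        ∑[ i < r ] 1                               ≡⟨ sum-cong-≗ one ⟩
        ∑[ i < r ] (edge v (g i) * χ A-t (g i))    ≤⟨ sum-≤-injective (λ w → edge v w * χ A-t w) g g-inj ⟩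
        ∑[ w < size G ] (edge v w * χ A-t w)       ≡⟨ nbrCount-sum A-t v ⟨
        nbrCount G A-t v                           ∎
        where open ≤-Reasoning

    percolating-if-eventually : (∀ v → EventuallyInfected r A v) → Percolating G r A
    percolating-if-eventually ev with eventually-simultaneously (λ v → v) ev
    ... | t , all∈ = t , all-in⇒⊤ _ all∈

    eventually-if-percolating : Percolating G r A → ∀ v → EventuallyInfected r A v
    eventually-if-percolating (t , A-t≡⊤) v =
      t , subst T (sym (trans (cong (λ B → isIn B v) A-t≡⊤) (isIn-⊤ v))) _

    step-keeps-out : ∀ B v → ¬ T (isIn B v) → nbrCount G B v < r → ¬ T (isIn (step G r B) v)
    step-keeps-out B v v∉B few v∈step with Equivalence.to T-∨ (subst T (isIn-step r B v) v∈step)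
    ... | inj₁ v∈B   = v∉B v∈B
    ... | inj₂ many  = <⇒≱ few (≤ᵇ⇒≤ r _ many)

    never-infected : ∀ v → ¬ T (isIn A v) → degree v < r → ∀ t → ¬ T (isIn (infected G r A t) v)
    never-infected v v∉A low zero    = v∉A
    never-infected v v∉A low (suc t) =
      step-keeps-out (infected G r A t) v (never-infected v v∉A low t)
        (≤-<-trans (nbrCount≤degree (infected G r A t) v) low)

    never-infected-edge : Symmetric → ∀ v w → T (adj G v w) → degree v ≤ r → degree w ≤ r →
      ¬ T (isIn A v) → ¬ T (isIn A w) →
      ∀ t → ¬ T (isIn (infected G r A t) v) × ¬ T (isIn (infected G r A t) w)
    never-infected-edge sym-adj v w v~w low-v low-w v∉A w∉A zero    = v∉A , w∉A
    never-infected-edge sym-adj v w v~w low-v low-w v∉A w∉A (suc t)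
      with never-infected-edge sym-adj v w v~w low-v low-w v∉A w∉A t
    ... | v∉ , w∉ =
      step-keeps-out A-t v v∉ (<-≤-trans (nbrCount<degree A-t v w v~w w∉) low-v) ,
      step-keeps-out A-t w w∉ (<-≤-trans (nbrCount<degree A-t w v (subst T (sym-adj v w) v~w) v∉) low-w)
      where A-t = infected G r A t

    percolating-low-degree : Percolating G r A → ∀ v → degree v < r → T (isIn A v)
    percolating-low-degree perc v low with T? (isIn A v)
    ... | yes v∈A = v∈A
    ... | no  v∉A with eventually-if-percolating perc v
    ...   | t , v∈ = ⊥-elim (never-infected v v∉A low t v∈)

    percolating-low-degree-edge : Symmetric → Percolating G r A → ∀ v w → T (adj G v w) →
      degree v ≤ r → degree w ≤ r → T (isIn A v) ⊎ T (isIn A w)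
    percolating-low-degree-edge sym-adj perc v w v~w low-v low-w with T? (isIn A v) | T? (isIn A w)
    ... | yes v∈A | _       = inj₁ v∈A
    ... | no  _   | yes w∈A = inj₂ w∈A
    ... | no  v∉A | no  w∉A with eventually-if-percolating perc v
    ...   | t , v∈ = ⊥-elim (proj₁ (never-infected-edge sym-adj v w v~w low-v low-w v∉A w∉A t) v∈)

  eventually-by-three : ∀ A v {u₁ u₂ u₃} → u₁ ≢ u₂ → u₁ ≢ u₃ → u₂ ≢ u₃ →
    T (adj G v u₁) → T (adj G v u₂) → T (adj G v u₃) →
    EventuallyInfected 3 A u₁ → EventuallyInfected 3 A u₂ → EventuallyInfected 3 A u₃ → EventuallyInfected 3 A v
  eventually-by-three A v {u₁} {u₂} {u₃} u₁≢u₂ u₁≢u₃ u₂≢u₃ v~u₁ v~u₂ v~u₃ ev₁ ev₂ ev₃ =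
    eventually-by-neighbours 3 A v u u-injective
      (λ { zero → v~u₁ ; (suc zero) → v~u₂ ; (suc (suc zero)) → v~u₃ })
      (λ { zero → ev₁ ; (suc zero) → ev₂ ; (suc (suc zero)) → ev₃ })
    where
    u : Fin 3 → V
    u zero             = u₁
    u (suc zero)       = u₂
    u (suc (suc zero)) = u₃
    u-injective : Injective _≡_ _≡_ u
    u-injective {zero}             {zero}             _  = refl
    u-injective {zero}             {suc zero}         eq = ⊥-elim (u₁≢u₂ eq)
    u-injective {zero}             {suc (suc zero)}   eq = ⊥-elim (u₁≢u₃ eq)
    u-injective {suc zero}         {zero}             eq = ⊥-elim (u₁≢u₂ (sym eq))
    u-injective {suc zero}         {suc zero}         _  = refl
    u-injective {suc zero}         {suc (suc zero)}   eq = ⊥-elim (u₂≢u₃ eq)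
    u-injective {suc (suc zero)}   {zero}             eq = ⊥-elim (u₁≢u₃ (sym eq))
    u-injective {suc (suc zero)}   {suc zero}         eq = ⊥-elim (u₂≢u₃ (sym eq))
    u-injective {suc (suc zero)}   {suc (suc zero)}   _  = refl

-- Cartesian products and paths

Loopless : Graph → Set
Loopless G = ∀ v → adj G v v ≡ false

module _ (G H : Graph) where

  private
    adjPairs : Fin (size G) × Fin (size H) → Fin (size G) × Fin (size H) → Bool
    adjPairs (g , h) (g′ , h′) = ((g =ᶠ g′) ∧ adj H h h′) ∨ ((h =ᶠ h′) ∧ adj G g g′)

    adj-remQuot : ∀ u v → adj (G □ H) u v ≡ adjPairs (remQuot (size H) u) (remQuot (size H) v)
    adj-remQuot u v with remQuot {size G} (size H) u | remQuot {size G} (size H) v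
    ... | _ | _ = refl

  adj-□ : ∀ g h g′ h′ →
    adj (G □ H) (combine g h) (combine g′ h′) ≡ ((g =ᶠ g′) ∧ adj H h h′) ∨ ((h =ᶠ h′) ∧ adj G g g′)
  adj-□ g h g′ h′ = trans (adj-remQuot (combine g h) (combine g′ h′))
    (cong₂ adjPairs (Fin.remQuot-combine {size G} {size H} g h) (Fin.remQuot-combine {size G} {size H} g′ h′))

  □-symmetric : Symmetric G → Symmetric H → Symmetric (G □ H)
  □-symmetric sym-G sym-H u v =
    trans (adj-remQuot u v) (trans (adjPairs-comm (remQuot (size H) u) (remQuot (size H) v)) (sym (adj-remQuot v u)))
    where
    adjPairs-comm : ∀ p q → adjPairs p q ≡ adjPairs q p
    adjPairs-comm (g , h) (g′ , h′) rewrite =ᶠ-comm g g′ | =ᶠ-comm h h′ | sym-G g g′ | sym-H h h′ = refl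

  edge-□ : Loopless G → ∀ g h g′ h′ →
    edge (G □ H) (combine g h) (combine g′ h′) ≡
    𝕀 (g =ᶠ g′) * edge H h h′ + 𝕀 (h =ᶠ h′) * edge G g g′
  edge-□ loopless g h g′ h′ rewrite adj-□ g h g′ h′ with g =ᶠ g′ in g=g′
  ... | false = 𝕀-∧ (h =ᶠ h′) (adj G g g′)
  ... | true rewrite =ᶠ⇒≡ {i = g} {g′} (subst T (sym g=g′) _) | loopless g′
             with adj H h h′ | h =ᶠ h′
  ...   | true  | true  = refl
  ...   | true  | false = refl
  ...   | false | true  = refl
  ...   | false | false = refl

  degree-□ : Loopless G → ∀ g h → degree (G □ H) (combine g h) ≡ degree H h + degree G g
  degree-□ loopless g h = begin
    degree (G □ H) (combine g h)
      ≡⟨ sum-combine (size G) (size H) _ ⟩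
    ∑[ g′ < size G ] ∑[ h′ < size H ] edge (G □ H) (combine g h) (combine g′ h′)
      ≡⟨ sum-cong-≗ (λ g′ → sum-cong-≗ (edge-□ loopless g h g′)) ⟩
    ∑[ g′ < size G ] ∑[ h′ < size H ] (𝕀 (g =ᶠ g′) * edge H h h′ + 𝕀 (h =ᶠ h′) * edge G g g′)
      ≡⟨ sum-cong-≗ (λ g′ → ∑-distrib-+ (λ h′ → 𝕀 (g =ᶠ g′) * edge H h h′) _) ⟩
    ∑[ g′ < size G ] (∑[ h′ < size H ] (𝕀 (g =ᶠ g′) * edge H h h′)
                        + ∑[ h′ < size H ] (𝕀 (h =ᶠ h′) * edge G g g′))
      ≡⟨ sum-cong-≗ (λ g′ → cong₂ _+_ (*-distribˡ-sum (𝕀 (g =ᶠ g′)) (edge H h))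
                                      (sym (sum-delta h (λ _ → edge G g g′)))) ⟨
    ∑[ g′ < size G ] (𝕀 (g =ᶠ g′) * degree H h + edge G g g′)
      ≡⟨ ∑-distrib-+ (λ g′ → 𝕀 (g =ᶠ g′) * degree H h) (edge G g) ⟩
    ∑[ g′ < size G ] (𝕀 (g =ᶠ g′) * degree H h) + degree G g
      ≡⟨ cong (_+ degree G g) (sum-delta g (λ _ → degree H h)) ⟩
    degree H h + degree G g ∎
    where open ≡-Reasoning

  degreeSum-□ : Loopless G →
    ∑[ u < size G * size H ] degree (G □ H) u ≡
    size G * ∑[ h < size H ] degree H h + size H * ∑[ g < size G ] degree G g
  degreeSum-□ loopless = begin
    ∑[ u < size G * size H ] degree (G □ H) u
      ≡⟨ sum-combine (size G) (size H) (degree (G □ H)) ⟩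
    ∑[ g < size G ] ∑[ h < size H ] degree (G □ H) (combine g h)
      ≡⟨ sum-cong-≗ (λ g → sum-cong-≗ (degree-□ loopless g)) ⟩
    ∑[ g < size G ] ∑[ h < size H ] (degree H h + degree G g)
      ≡⟨ sum-cong-≗ (λ g → trans (∑-distrib-+ (degree H) (λ _ → degree G g))
                                 (cong (_ +_) (sum-const (size H) (degree G g)))) ⟩
    ∑[ g < size G ] (∑[ h < size H ] degree H h + size H * degree G g)
      ≡⟨ ∑-distrib-+ (λ _ → ∑[ h < size H ] degree H h) (λ g → size H * degree G g) ⟩
    ∑[ g < size G ] ∑[ h < size H ] degree H h + ∑[ g < size G ] (size H * degree G g)
      ≡⟨ cong₂ _+_ (sum-const (size G) _) (sym (*-distribˡ-sum (size H) (degree G))) ⟩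
    size G * ∑[ h < size H ] degree H h + size H * ∑[ g < size G ] degree G g ∎
    where open ≡-Reasoning

  adj-□-left : ∀ {g g′} h → T (adj G g g′) → T (adj (G □ H) (combine g h) (combine g′ h))
  adj-□-left {g} {g′} h g~g′ =
    subst T (sym (adj-□ g h g′ h)) (Equivalence.from T-∨ (inj₂ (Equivalence.from T-∧ (=ᶠ-refl h , g~g′))))

  adj-□-right : ∀ g {h h′} → T (adj H h h′) → T (adj (G □ H) (combine g h) (combine g h′))
  adj-□-right g {h} {h′} h~h′ =
    subst T (sym (adj-□ g h g h′)) (Equivalence.from T-∨ (inj₁ (Equivalence.from T-∧ (=ᶠ-refl g , h~h′))))

P-symmetric : ∀ n → Symmetric (P n)
P-symmetric n i j = ∨-comm (suc (toℕ i) ≡ᵇ toℕ j) (suc (toℕ j) ≡ᵇ toℕ i)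

suc-≡ᵇ-false : ∀ m → (suc m ≡ᵇ m) ≡ false
suc-≡ᵇ-false zero    = refl
suc-≡ᵇ-false (suc m) = suc-≡ᵇ-false m

P-loopless : ∀ n → Loopless (P n)
P-loopless n i rewrite suc-≡ᵇ-false (toℕ i) = refl

count-≡ᵇ≤1 : ∀ n c → ∑[ j < n ] 𝕀 (toℕ j ≡ᵇ c) ≤ 1
count-≡ᵇ≤1 zero    c       = z≤n
count-≡ᵇ≤1 (suc n) zero    = ≤-reflexive (cong suc (sum-zero n))
count-≡ᵇ≤1 (suc n) (suc c) = count-≡ᵇ≤1 n c

count-≡ᵇ≡0 : ∀ n c → n ≤ c → ∑[ j < n ] 𝕀 (toℕ j ≡ᵇ c) ≡ 0
count-≡ᵇ≡0 zero    c       n≤c       = refl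
count-≡ᵇ≡0 (suc n) (suc c) (s≤s n≤c) = count-≡ᵇ≡0 n c n≤c

count-suc-≡ᵇ≤1 : ∀ n c → ∑[ j < n ] 𝕀 (suc (toℕ j) ≡ᵇ c) ≤ 1
count-suc-≡ᵇ≤1 n zero    = ≤-trans (≤-reflexive (sum-zero n)) z≤n
count-suc-≡ᵇ≤1 n (suc c) = count-≡ᵇ≤1 n c

count-zero-≡ᵇ : ∀ n → ∑[ j < suc n ] 𝕀 (0 ≡ᵇ toℕ j) ≡ 1
count-zero-≡ᵇ n = cong suc (sum-zero n)

𝕀-∨-≤ : ∀ x y → 𝕀 (x ∨ y) ≤ 𝕀 x + 𝕀 y
𝕀-∨-≤ true  y = s≤s z≤n
𝕀-∨-≤ false y = ≤-refl

edge-P≤ : ∀ n (i j : Fin n) →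
          edge (P n) i j ≤ 𝕀 (toℕ j ≡ᵇ suc (toℕ i)) + 𝕀 (suc (toℕ j) ≡ᵇ toℕ i)
edge-P≤ n i j rewrite ≡ᵇ-comm (suc (toℕ i)) (toℕ j) = 𝕀-∨-≤ (toℕ j ≡ᵇ suc (toℕ i)) _

degree-P≤ : ∀ n i →
            degree (P n) i ≤ ∑[ j < n ] 𝕀 (toℕ j ≡ᵇ suc (toℕ i)) + ∑[ j < n ] 𝕀 (suc (toℕ j) ≡ᵇ toℕ i)
degree-P≤ n i = ≤-trans (sum-mono-≤ {n} (edge-P≤ n i))
  (≤-reflexive (∑-distrib-+ {n} (λ j → 𝕀 (toℕ j ≡ᵇ suc (toℕ i))) (λ j → 𝕀 (suc (toℕ j) ≡ᵇ toℕ i))))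

degree-P≤2 : ∀ n i → degree (P n) i ≤ 2
degree-P≤2 n i =
  ≤-trans (degree-P≤ n i) (+-mono-≤ (count-≡ᵇ≤1 n (suc (toℕ i))) (count-suc-≡ᵇ≤1 n (toℕ i)))

degree-P-first≤1 : ∀ n → degree (P (suc n)) zero ≤ 1
degree-P-first≤1 n = begin
  degree (P (suc n)) zero                           ≤⟨ degree-P≤ (suc n) zero ⟩
  ∑[ j < suc n ] 𝕀 (toℕ j ≡ᵇ 1) + ∑[ j < suc n ] 0  ≡⟨ cong (∑[ j < suc n ] 𝕀 (toℕ j ≡ᵇ 1) +_) (sum-zero (suc n)) ⟩
  ∑[ j < suc n ] 𝕀 (toℕ j ≡ᵇ 1) + 0                 ≡⟨ +-identityʳ _ ⟩
  ∑[ j < suc n ] 𝕀 (toℕ j ≡ᵇ 1)                     ≤⟨ count-≡ᵇ≤1 (suc n) 1 ⟩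
  1                                                 ∎
  where open ≤-Reasoning

degree-P-last≤1 : ∀ n i → suc (toℕ i) ≡ n → degree (P n) i ≤ 1
degree-P-last≤1 n i last = ≤-trans (degree-P≤ n i)
  (subst (λ x → x + ∑[ j < n ] 𝕀 (suc (toℕ j) ≡ᵇ toℕ i) ≤ 1)
     (sym (count-≡ᵇ≡0 n (suc (toℕ i)) (≤-reflexive (sym last))))
    (count-suc-≡ᵇ≤1 n (toℕ i)))

degreeSum-P : ∀ n → ∑[ i < suc n ] degree (P (suc n)) i ≡ 2 * n
degreeSum-P zero    = refl
degreeSum-P (suc n) = begin
  degree (P (2 + n)) zero + ∑[ i < suc n ] (𝕀 (0 ≡ᵇ toℕ i) + degree (P (suc n)) i)
    ≡⟨ cong₂ _+_ first-degree (∑-distrib-+ (λ i → 𝕀 (0 ≡ᵇ toℕ i)) (degree (P (suc n)))) ⟩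
  1 + (∑[ i < suc n ] 𝕀 (0 ≡ᵇ toℕ i) + ∑[ i < suc n ] degree (P (suc n)) i)
    ≡⟨ cong₂ (λ a b → 1 + (a + b)) (count-zero-≡ᵇ n) (degreeSum-P n) ⟩
  2 + 2 * n
    ≡⟨ *-distribˡ-+ 2 1 n ⟨
  2 * suc n ∎
  where
  open ≡-Reasoning
  first-degree : degree (P (2 + n)) zero ≡ 1
  first-degree = begin
    ∑[ j < suc n ] 𝕀 ((0 ≡ᵇ toℕ j) ∨ false) ≡⟨ sum-cong-≗ {suc n} (cong 𝕀 ∘ ∨-identityʳ ∘ (0 ≡ᵇ_) ∘ toℕ) ⟩
    ∑[ j < suc n ] 𝕀 (0 ≡ᵇ toℕ j)           ≡⟨ count-zero-≡ᵇ n ⟩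
    1                                       ∎

adj-P-suc : ∀ {n} {j j′ : Fin n} → suc (toℕ j) ≡ toℕ j′ → T (adj (P n) j j′)
adj-P-suc {j = j} {j′} j+1≡j′ = Equivalence.from T-∨ (inj₁ (≡⇒≡ᵇ (suc (toℕ j)) (toℕ j′) j+1≡j′))

-- Indices beyond m are clamped to m, so statements about them carry a hypothesis k ≤ m.
clamp : ∀ m → ℕ → Fin (suc m)
clamp m       zero    = zero
clamp zero    (suc k) = zero
clamp (suc m) (suc k) = suc (clamp m k)

toℕ-clamp : ∀ {m k} → k ≤ m → toℕ (clamp m k) ≡ k
toℕ-clamp {m}     {zero}  _         = refl
toℕ-clamp {suc m} {suc k} (s≤s k≤m) = cong suc (toℕ-clamp k≤m)

clamp-injective : ∀ {m k k′} → k ≤ m → k′ ≤ m → clamp m k ≡ clamp m k′ → k ≡ k′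
clamp-injective k≤m k′≤m eq = trans (sym (toℕ-clamp k≤m)) (trans (cong toℕ eq) (toℕ-clamp k′≤m))

clamp-toℕ : ∀ {m} (j : Fin (suc m)) → clamp m (toℕ j) ≡ j
clamp-toℕ {m}     zero    = refl
clamp-toℕ {suc m} (suc j) = cong suc (clamp-toℕ j)

consecutive-trues : ∀ q (f : ℕ → Bool) → T (f 0) → T (f (suc (q * 2))) →
  (∀ k → k < suc (q * 2) → T (f k ∨ f (suc k))) → ∃ λ k → k < suc (q * 2) × T (f k) × T (f (suc k))
consecutive-trues zero f f0 f1 gaps = 0 , s≤s z≤n , f0 , f1
consecutive-trues (suc q) f f0 flast gaps with T? (f 1) | Equivalence.to T-∨ (gaps 1 (s≤s (s≤s z≤n)))
... | yes f1 | _      = 0 , s≤s z≤n , f0 , f1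
... | no ¬f1 | inj₁ f1 = ⊥-elim (¬f1 f1)
... | no _   | inj₂ f2 with consecutive-trues q (f ∘ (2 +_)) f2 flast (λ k k< → gaps (2 + k) (s≤s (s≤s k<)))
...   | k , k< , fk , fk+1 = 2 + k , s≤s (s≤s k<) , fk , fk+1

-- The 5 × (m + 1) grid and the lower bound

-- An outer row o of the grid together with its neighbouring inner row i.
data Band : Fin 5 → Fin 5 → Set where
  upper : Band zero (suc zero)
  lower : Band (suc (suc (suc (suc zero)))) (suc (suc (suc zero)))

centre : Fin 5
centre = suc (suc zero)

band-vertical : ∀ {o i} → Band o i → T (adj (P 5) o i)
band-vertical upper = _
band-vertical lower = _

band-vertical⁻ : ∀ {o i} → Band o i → T (adj (P 5) i o)
band-vertical⁻ upper = _
band-vertical⁻ lower = _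

band-centre : ∀ {o i} → Band o i → T (adj (P 5) i centre)
band-centre upper = _
band-centre lower = _

band-degree : ∀ {o i} → Band o i → degree (P 5) o ≡ 1
band-degree upper = refl
band-degree lower = refl

band-outer≢inner : ∀ {o i} → Band o i → o ≢ i
band-outer≢inner upper ()
band-outer≢inner lower ()

band-outer≢centre : ∀ {o i} → Band o i → o ≢ centre
band-outer≢centre upper ()
band-outer≢centre lower ()

band-inner≢centre : ∀ {o i} → Band o i → i ≢ centre
band-inner≢centre upper ()
band-inner≢centre lower ()

module Grid (m : ℕ) where

  Grid : Graph
  Grid = P 5 □ P (suc m)

  cell : Fin 5 → ℕ → Fin (size Grid)
  cell i k = combine i (clamp m k)

  grid-symmetric : Symmetric Grid
  grid-symmetric = □-symmetric (P 5) (P (suc m)) (P-symmetric 5) (P-symmetric (suc m))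

  degree-cell : ∀ i j → degree Grid (combine i j) ≡ degree (P (suc m)) j + degree (P 5) i
  degree-cell = degree-□ (P 5) (P (suc m)) (P-loopless 5)

  orderedEdges-grid : orderedEdges Grid ⊤ + 10 ≡ 18 * suc m
  orderedEdges-grid = begin
    orderedEdges Grid ⊤ + 10
      ≡⟨ cong (_+ 10) (trans (orderedEdges-⊤ Grid) (degreeSum-□ (P 5) (P (suc m)) (P-loopless 5))) ⟩
    5 * ∑[ j < suc m ] degree (P (suc m)) j + suc m * 8 + 10
      ≡⟨ cong (λ d → 5 * d + suc m * 8 + 10) (degreeSum-P m) ⟩
    5 * (2 * m) + suc m * 8 + 10
      ≡⟨ count m ⟩
    18 * suc m ∎
    where
    open ≡-Reasoning
    count : ∀ m → 5 * (2 * m) + suc m * 8 + 10 ≡ 18 * suc m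
    count = solve-∀

  horizontal : ∀ i {k} → suc k ≤ m → T (adj Grid (cell i k) (cell i (suc k)))
  horizontal i {k} k<m =
    adj-□-right (P 5) (P (suc m)) i
      (adj-P-suc (trans (cong suc (toℕ-clamp (≤-trans (n≤1+n k) k<m))) (sym (toℕ-clamp k<m))))

  horizontal⁻ : ∀ i {k} → suc k ≤ m → T (adj Grid (cell i (suc k)) (cell i k))
  horizontal⁻ i {k} k<m = subst T (grid-symmetric (cell i k) (cell i (suc k))) (horizontal i k<m)

  vertical : ∀ i i′ k → T (adj (P 5) i i′) → T (adj Grid (cell i k) (cell i′ k))
  vertical i i′ k = adj-□-left (P 5) (P (suc m)) {i} {i′} (clamp m k)

  cell-≢-row : ∀ {i i′} k k′ → i ≢ i′ → cell i k ≢ cell i′ k′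
  cell-≢-row {i} {i′} k k′ i≢i′ = i≢i′ ∘ Fin.combine-injectiveˡ i (clamp m k) i′ (clamp m k′)

  cell-≢-column : ∀ i i′ {k k′} → k ≤ m → k′ ≤ m → k ≢ k′ → cell i k ≢ cell i′ k′
  cell-≢-column i i′ {k} {k′} k≤m k′≤m k≢k′ =
    k≢k′ ∘ clamp-injective k≤m k′≤m ∘ Fin.combine-injectiveʳ i (clamp m k) i′ (clamp m k′)

  degree-outer-cell : ∀ {o i} → Band o i → ∀ j → degree Grid (combine o j) ≡ degree (P (suc m)) j + 1
  degree-outer-cell {o} b j = trans (degree-cell o j) (cong (degree (P (suc m)) j +_) (band-degree b))

  module LowerBound (A : Subset (size Grid)) (perc : Percolating Grid 3 A) where

    potential-grid : orderedEdges Grid A + 12 * suc m + 10 ≤ 6 * ∣ A ∣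
    potential-grid = +-cancelˡ-≤ (18 * suc m) _ _ $ begin
      18 * suc m + (orderedEdges Grid A + 12 * suc m + 10)
        ≡⟨ regroup (orderedEdges Grid A) m ⟩
      orderedEdges Grid A + 6 * (5 * suc m) + 10
        ≤⟨ +-monoˡ-≤ 10 (potential-percolating Grid grid-symmetric 3 A perc) ⟩
      orderedEdges Grid ⊤ + 6 * ∣ A ∣ + 10
        ≡⟨ +-comm-last (orderedEdges Grid ⊤) (6 * ∣ A ∣) 10 ⟩
      orderedEdges Grid ⊤ + 10 + 6 * ∣ A ∣
        ≡⟨ cong (_+ 6 * ∣ A ∣) orderedEdges-grid ⟩
      18 * suc m + 6 * ∣ A ∣ ∎
      where
      open ≤-Reasoning
      regroup : ∀ e m → 18 * suc m + (e + 12 * suc m + 10) ≡ e + 6 * (5 * suc m) + 10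
      regroup = solve-∀
      +-comm-last : ∀ a b c → a + b + c ≡ a + c + b
      +-comm-last = solve-∀

    ∣A∣-bound : ∀ c → 6 * c < orderedEdges Grid A + 10 → 2 * suc m + c < ∣ A ∣
    ∣A∣-bound c small = *-cancelˡ-< 6 (2 * suc m + c) ∣ A ∣ $ begin-strict
      6 * (2 * suc m + c)                     ≡⟨ expand m c ⟩
      12 * suc m + 6 * c                      <⟨ +-monoʳ-< (12 * suc m) small ⟩
      12 * suc m + (orderedEdges Grid A + 10) ≡⟨ regroup m (orderedEdges Grid A) ⟩
      orderedEdges Grid A + 12 * suc m + 10   ≤⟨ potential-grid ⟩
      6 * ∣ A ∣                               ∎
      where
      open ≤-Reasoning
      expand : ∀ m c → 6 * (2 * suc m + c) ≡ 12 * suc m + 6 * c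
      expand = solve-∀
      regroup : ∀ m e → 12 * suc m + (e + 10) ≡ e + 12 * suc m + 10
      regroup = solve-∀

    private
      contribution : Fin (size Grid) → ℕ
      contribution v = χ A v * nbrCount Grid A v

      row : Fin 5 → ℕ
      row i = ∑[ j < suc m ] contribution (combine i j)

    orderedEdges-outer-rows : row zero + row (suc (suc (suc (suc zero)))) ≤ orderedEdges Grid A
    orderedEdges-outer-rows = begin
      row zero + row (suc (suc (suc (suc zero)))) ≤⟨ two-terms≤sum row {zero} {suc (suc (suc (suc zero)))} (λ ()) ⟩
      ∑[ i < 5 ] row i                            ≡⟨ sum-combine 5 (suc m) contribution ⟨
      ∑[ v < size Grid ] contribution v           ≡⟨ adjForm-χʳ Grid (χ A) A ⟨
      orderedEdges Grid A                         ∎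
      where open ≤-Reasoning

    adjacent-pair-in-outer-row : ∀ {o i} → Band o i → ∀ q → m ≡ suc (q * 2) →
      ∃ λ k → k < m × T (isIn A (cell o k)) × T (isIn A (cell o (suc k)))
    adjacent-pair-in-outer-row {o} b q refl =
      consecutive-trues q (λ k → isIn A (cell o k)) first∈A last∈A
        λ k k<m → Equivalence.from T-∨ (percolating-low-degree-edge Grid 3 A grid-symmetric perc
          (cell o k) (cell o (suc k)) (horizontal o k<m) (degree≤3 _) (degree≤3 _))
      where
      degree≤3 : ∀ j → degree Grid (combine o j) ≤ 3
      degree≤3 j = subst (_≤ 3) (sym (degree-outer-cell b j)) (+-monoˡ-≤ 1 (degree-P≤2 (suc m) j))
      first∈A : T (isIn A (cell o 0))
      first∈A = percolating-low-degree Grid 3 A perc (cell o 0)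
        (subst (_< 3) (sym (degree-outer-cell b zero)) (s≤s (+-monoˡ-≤ 1 (degree-P-first≤1 m))))
      last∈A : T (isIn A (cell o m))
      last∈A = percolating-low-degree Grid 3 A perc (cell o m)
        (subst (_< 3) (sym (degree-outer-cell b (clamp m m)))
          (s≤s (+-monoˡ-≤ 1 (degree-P-last≤1 (suc m) (clamp m m) (cong suc (toℕ-clamp ≤-refl))))))

    outer-row≥2 : ∀ {o i} → Band o i → ∀ q → m ≡ suc (q * 2) → 2 ≤ row o
    outer-row≥2 {o} b q even-width with adjacent-pair-in-outer-row b q even-width
    ... | k , k<m , k∈A , k+1∈A = begin
      2
        ≤⟨ +-mono-≤ (1≤χ*nbrCount Grid A _ _ (horizontal o k<m) k∈A k+1∈A)
                    (1≤χ*nbrCount Grid A _ _ (horizontal⁻ o k<m) k+1∈A k∈A) ⟩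
      contribution (cell o k) + contribution (cell o (suc k))
        ≤⟨ two-terms≤sum (λ j → contribution (combine o j))
             (<⇒≢ (n<1+n k) ∘ clamp-injective (≤-trans (n≤1+n k) k<m) k<m) ⟩
      row o ∎
      where open ≤-Reasoning

    orderedEdges≥4 : ∀ q → m ≡ suc (q * 2) → 4 ≤ orderedEdges Grid A
    orderedEdges≥4 q even-width =
      ≤-trans (+-mono-≤ (outer-row≥2 upper q even-width) (outer-row≥2 lower q even-width)) orderedEdges-outer-rows

    lower-bound : 2 * suc m + 2 ≤ ∣ A ∣
    lower-bound = subst (_≤ ∣ A ∣) (sym (+-suc (2 * suc m) 1))
      (∣A∣-bound 1 (≤-trans (m≤n+m 7 3) (m≤n+m 10 (orderedEdges Grid A))))

    lower-bound-even : ∀ q → m ≡ suc (q * 2) → 2 * suc m + 3 ≤ ∣ A ∣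
    lower-bound-even q even-width = subst (_≤ ∣ A ∣) (sym (+-suc (2 * suc m) 2))
      (∣A∣-bound 2 (≤-trans (n≤1+n 13) (+-monoˡ-≤ 10 (orderedEdges≥4 q even-width))))

-- A percolating seed

data Column : Set where
  triple outer inner : Column

rowsOf : Column → Subset 5
rowsOf triple = inside  ∷ outside ∷ inside  ∷ outside ∷ inside  ∷ []
rowsOf outer  = inside  ∷ outside ∷ outside ∷ outside ∷ inside  ∷ []
rowsOf inner  = outside ∷ inside  ∷ outside ∷ inside  ∷ outside ∷ []

-- Column types of the seed: column 0 and every column from n * 2 on are triple; in between they
-- alternate between outer (even columns) and inner (odd columns).
stripe : ℕ → ℕ → Column
stripe zero    k                   = triple
stripe (suc n) zero                = outer
stripe (suc n) (suc zero)          = inner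
stripe (suc n) (suc (suc k))       = stripe n k

column : ℕ → ℕ → Column
column n zero    = triple
column n (suc k) = stripe n (suc k)

stripe-zero≢inner : ∀ n → stripe n 0 ≢ inner
stripe-zero≢inner zero    ()
stripe-zero≢inner (suc n) ()

stripe-inner-next : ∀ n k → stripe n k ≡ inner → stripe n (suc k) ≢ inner
stripe-inner-next (suc n) (suc zero)    _   = stripe-zero≢inner n
stripe-inner-next (suc n) (suc (suc k)) inn = stripe-inner-next n k inn

stripe-inner-prev : ∀ n k → stripe n (suc k) ≡ inner → stripe n k ≢ inner
stripe-inner-prev (suc n) zero          _   ()
stripe-inner-prev (suc n) (suc zero)    inn = ⊥-elim (stripe-zero≢inner n inn)
stripe-inner-prev (suc n) (suc (suc k)) inn = stripe-inner-prev n k inn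

stripe-outer-next : ∀ n k → stripe n k ≡ outer → stripe n (suc k) ≡ inner
stripe-outer-next (suc n) zero          _   = refl
stripe-outer-next (suc n) (suc (suc k)) out = stripe-outer-next n k out

stripe-boundary : ∀ n k → stripe n k ≢ triple → k < n * 2
stripe-boundary zero    k             not-triple = ⊥-elim (not-triple refl)
stripe-boundary (suc n) zero          _          = s≤s z≤n
stripe-boundary (suc n) (suc zero)    _          = s≤s (s≤s z≤n)
stripe-boundary (suc n) (suc (suc k)) not-triple = s≤s (s≤s (stripe-boundary n k not-triple))

stripe-size : ∀ n e → ∑[ j < n * 2 + e ] ∣ rowsOf (stripe n (toℕ j)) ∣ ≡ n * 4 + e * 3
stripe-size zero    e = sum-const e 3
stripe-size (suc n) e = cong (4 +_) (stripe-size n e)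

column≢inner : ∀ n k → stripe n k ≢ inner → column n k ≢ inner
column≢inner n zero    _         ()
column≢inner n (suc k) not-inner = not-inner

band-outer : ∀ {o i} → Band o i → ∀ c → c ≢ inner → T (isIn (rowsOf c) o)
band-outer _     inner  not-inner = ⊥-elim (not-inner refl)
band-outer upper triple _         = _
band-outer lower triple _         = _
band-outer upper outer  _         = _
band-outer lower outer  _         = _

band-inner : ∀ {o i} → Band o i → T (isIn (rowsOf inner) i)
band-inner upper = _
band-inner lower = _

module Construction (p e : ℕ) where

  private
    n = suc p
    m = e + n * 2

  open Grid m

  private
    seedAt : Fin 5 × Fin (suc m) → Bool
    seedAt (i , j) = isIn (rowsOf (column n (toℕ j))) i

  seed : Subset (size Grid)
  seed = tabulate (seedAt ∘ remQuot {5} (suc m))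

  isIn-seed : ∀ i j → isIn seed (combine i j) ≡ isIn (rowsOf (column n (toℕ j))) i
  isIn-seed i j = trans (isIn≡lookup seed (combine i j))
    (trans (lookup∘tabulate (seedAt ∘ remQuot {5} (suc m)) (combine i j)) (cong seedAt (Fin.remQuot-combine i j)))

  ∣seed∣ : ∣ seed ∣ ≡ 2 * suc m + 2 + e
  ∣seed∣ = begin
    ∣ seed ∣
      ≡⟨ ∣∣≡sum-χ seed ⟩
    sum (χ seed)
      ≡⟨ sum-combine 5 (suc m) (χ seed) ⟩
    ∑[ i < 5 ] ∑[ j < suc m ] χ seed (combine i j)
      ≡⟨ sum-cong-≗ (λ i → sum-cong-≗ (λ j → cong 𝕀 (isIn-seed i j))) ⟩
    ∑[ i < 5 ] ∑[ j < suc m ] χ (rowsOf (column n (toℕ j))) i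
      ≡⟨ ∑-comm {5} {suc m} (λ i j → χ (rowsOf (column n (toℕ j))) i) ⟩
    ∑[ j < suc m ] ∑[ i < 5 ] χ (rowsOf (column n (toℕ j))) i
      ≡⟨ sum-cong-≗ {suc m} (λ j → ∣∣≡sum-χ (rowsOf (column n (toℕ j)))) ⟨
    -- column 0 (triple) has one row more than stripe n 0 (outer); all other columns agree
    suc (∑[ j < suc m ] ∣ rowsOf (stripe n (toℕ j)) ∣)
      ≡⟨ cong (λ k → suc (∑[ j < k ] ∣ rowsOf (stripe n (toℕ j)) ∣)) (+-comm (suc e) (n * 2)) ⟩
    suc (∑[ j < n * 2 + suc e ] ∣ rowsOf (stripe n (toℕ j)) ∣)
      ≡⟨ cong suc (stripe-size n (suc e)) ⟩
    suc (n * 4 + suc e * 3)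
      ≡⟨ count p e ⟩
    2 * suc m + 2 + e ∎
    where
    open ≡-Reasoning
    count : ∀ p e → suc (suc p * 4 + suc e * 3) ≡ 2 * suc (e + suc p * 2) + 2 + e
    count = solve-∀

  Infected : Fin 5 → ℕ → Set
  Infected i k = EventuallyInfected Grid 3 seed (cell i k)

  seeded : ∀ i {k c} → k ≤ m → column n k ≡ c → T (isIn (rowsOf c) i) → Infected i k
  seeded i {k} k≤m refl i∈c = 0 , subst T (sym isIn-seed-cell) i∈c
    where
    isIn-seed-cell : isIn seed (cell i k) ≡ isIn (rowsOf (column n k)) i
    isIn-seed-cell = trans (isIn-seed i (clamp m k)) (cong (λ k → isIn (rowsOf (column n k)) i) (toℕ-clamp k≤m))

  before-boundary : ∀ {k} → stripe n (suc k) ≢ triple → suc (suc k) ≤ m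
  before-boundary {k} not-triple = ≤-trans (stripe-boundary n (suc k) not-triple) (m≤n+m (n * 2) e)

  outer-row : ∀ {o i} → Band o i → ∀ k → k ≤ m → Infected o k
  outer-row {o} b zero    k≤m = seeded o k≤m refl (band-outer b triple λ ())
  outer-row {o} {i} b (suc k) k<m with stripe n (suc k) in col
  ... | triple = seeded o k<m col (band-outer b triple λ ())
  ... | outer  = seeded o k<m col (band-outer b outer λ ())
  ... | inner  = eventually-by-three Grid seed (cell o (suc k))
    (cell-≢-row (suc k) k (band-outer≢inner b ∘ sym)) (cell-≢-row (suc k) (suc (suc k)) (band-outer≢inner b ∘ sym))
    (cell-≢-column o o k≤m k+2≤m (<⇒≢ (m<n+m k z<s)))
    (vertical o i (suc k) (band-vertical b)) (horizontal⁻ o k<m) (horizontal o k+2≤m)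
    (seeded i k<m col (band-inner b))
    (seeded o k≤m refl (band-outer b _ (column≢inner n k (stripe-inner-prev n k col))))
    (seeded o k+2≤m refl (band-outer b _ (stripe-inner-next n (suc k) col)))
    where
    k≤m = ≤-trans (n≤1+n k) k<m
    k+2≤m = before-boundary λ eq → case trans (sym col) eq of λ ()

  inner-row : ∀ {o i} → Band o i → ∀ k → k ≤ m → Infected i k
  inner-row {o} {i} b zero _ = eventually-by-three Grid seed (cell i 0)
    (cell-≢-row 0 0 (band-outer≢centre b)) (cell-≢-row 0 1 (band-outer≢inner b))
    (cell-≢-row 0 1 (band-inner≢centre b ∘ sym))
    (vertical i o 0 (band-vertical⁻ b)) (vertical i centre 0 (band-centre b)) (horizontal i 1≤m)
    (seeded o z≤n refl (band-outer b triple λ ())) (seeded centre z≤n refl _) (seeded i 1≤m refl (band-inner b))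
    where
    1≤m = ≤-trans (s≤s z≤n) (m≤n+m (n * 2) e)
  inner-row {o} {i} b (suc k) k<m with stripe n (suc k) in col
  ... | inner  = seeded i k<m col (band-inner b)
  ... | triple = eventually-by-three Grid seed (cell i (suc k))
    (cell-≢-row (suc k) (suc k) (band-outer≢centre b)) (cell-≢-row (suc k) k (band-outer≢inner b))
    (cell-≢-row (suc k) k (band-inner≢centre b ∘ sym))
    (vertical i o (suc k) (band-vertical⁻ b)) (vertical i centre (suc k) (band-centre b)) (horizontal⁻ i k<m)
    (seeded o k<m col (band-outer b triple λ ())) (seeded centre k<m col _) (inner-row b k k≤m)
    where
    k≤m = ≤-trans (n≤1+n k) k<m
  ... | outer  = eventually-by-three Grid seed (cell i (suc k))
    (cell-≢-row (suc k) k (band-outer≢inner b)) (cell-≢-row (suc k) (suc (suc k)) (band-outer≢inner b))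
    (cell-≢-column i i k≤m k+2≤m (<⇒≢ (m<n+m k z<s)))
    (vertical i o (suc k) (band-vertical⁻ b)) (horizontal⁻ i k<m) (horizontal i k+2≤m)
    (seeded o k<m col (band-outer b outer λ ())) (inner-row b k k≤m)
    (seeded i k+2≤m (stripe-outer-next n (suc k) col) (band-inner b))
    where
    k≤m = ≤-trans (n≤1+n k) k<m
    k+2≤m = before-boundary λ eq → case trans (sym col) eq of λ ()

  private
    row₁ row₃ : Fin 5
    row₁ = suc zero
    row₃ = suc (suc (suc zero))

  centre-row : ∀ k → k ≤ m → Infected centre k
  centre-row zero    k≤m = seeded centre k≤m refl _
  centre-row (suc k) k<m = eventually-by-three Grid seed (cell centre (suc k))
    {cell row₁ (suc k)} {cell row₃ (suc k)} {cell centre k}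
    (cell-≢-row {row₁} {row₃} (suc k) (suc k) (λ ())) (cell-≢-row {row₁} {centre} (suc k) k (λ ()))
    (cell-≢-row {row₃} {centre} (suc k) k (λ ()))
    (vertical centre row₁ (suc k) _) (vertical centre row₃ (suc k) _) (horizontal⁻ centre k<m)
    (inner-row upper (suc k) k<m) (inner-row lower (suc k) k<m) (centre-row k (≤-trans (n≤1+n k) k<m))

  every-row : ∀ i k → k ≤ m → Infected i k
  every-row zero                            = outer-row upper
  every-row (suc zero)                      = inner-row upper
  every-row (suc (suc zero))                = centre-row
  every-row (suc (suc (suc zero)))          = inner-row lower
  every-row (suc (suc (suc (suc zero))))    = outer-row lower

  seed-percolates : Percolating Grid 3 seed
  seed-percolates = percolating-if-eventually Grid 3 seed λ v →
    subst (EventuallyInfected Grid 3 seed) (Fin.combine-remQuot {5} (suc m) v) (at (remQuot {5} (suc m) v))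
    where
    at : ∀ ((i , j) : Fin 5 × Fin (suc m)) → EventuallyInfected Grid 3 seed (combine i j)
    at (i , j) =
      subst (EventuallyInfected Grid 3 seed ∘ combine i) (clamp-toℕ j) (every-row i (toℕ j) (Fin.toℕ≤pred[n] j))

odd-form : ∀ m → 5 ≤ m → m % 2 ≡ 1 → ∃ λ p → m ≡ suc (suc p * 2)
odd-form m 5≤m m-odd with m / 2 | m≡m%n+[m/n]*n m 2
... | zero  | m≡ = case subst (5 ≤_) (trans m≡ (cong (_+ 0) m-odd)) 5≤m of λ { (s≤s ()) }
... | suc p | m≡ = p , trans m≡ (cong (_+ suc p * 2) m-odd)

even-form : ∀ m → 5 ≤ m → m % 2 ≡ 0 → ∃ λ p → m ≡ suc (suc (suc p * 2))
even-form m 5≤m m-even with m / 2 | m≡m%n+[m/n]*n m 2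
... | zero        | m≡ = case subst (5 ≤_) (trans m≡ (cong (_+ 0) m-even)) 5≤m of λ ()
... | suc zero    | m≡ = case subst (5 ≤_) (trans m≡ (cong (_+ 2) m-even)) 5≤m of λ { (s≤s (s≤s ())) }
... | suc (suc p) | m≡ = p , trans m≡ (cong (_+ suc (suc p) * 2) m-even)

theorem2 : (m : ℕ) → 5 ≤ m →
    ((m % 2 ≡ 1) → IsPercolationNumber (P 5 □ P m) 3 (2 * m + 2))
    × ((m % 2 ≡ 0) → IsPercolationNumber (P 5 □ P m) 3 (2 * m + 3))
theorem2 m 5≤m = odd-case , even-case
  where
  odd-case : m % 2 ≡ 1 → IsPercolationNumber (P 5 □ P m) 3 (2 * m + 2)
  odd-case m-odd with odd-form m 5≤m m-odd
  ... | p , refl = (seed , trans ∣seed∣ (+-identityʳ _) , seed-percolates)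
                 , λ A perc → LowerBound.lower-bound A perc
    where
    open Construction p 0
    open Grid (suc p * 2)

  even-case : m % 2 ≡ 0 → IsPercolationNumber (P 5 □ P m) 3 (2 * m + 3)
  even-case m-even with even-form m 5≤m m-even
  ... | p , refl = (seed , trans ∣seed∣ (+-assoc (2 * m) 2 1) , seed-percolates)
                 , λ A perc → LowerBound.lower-bound-even A perc (suc p) refl
    where
    open Construction p 1
    open Grid (suc (suc p * 2))
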